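{- Let $G_1,\ldots,G_n$ be nondeterministic automata, where $G_i$ has set of secret states $Q_i^S$, and consider the composed system $G_1\|\cdots\|G_n$ with interaction $\|_\lor$, i.e. with set of secret states $Q^S=Q\setminus(Q_1^{NS}\times\cdots\times Q_n^{NS})$, $Q_i^{NS}=Q_i\setminus Q_i^S$. For $1\le i\le n$ let $H_i=\Delta(det(G_i))\|\Delta_R(det(G_{i,R}))$ be the two-way observer of $G_i$. If every state reachable in $H_1\|\cdots\|H_n$, i.e. every $((X^1,X^1_R),\ldots,(X^n,X^n_R))$ with $H_1\|\cdots\|H_n\stackrel{s}{\to}((X^1,X^1_R),\ldots,(X^n,X^n_R))$ for some $s$, satisfies, for all $1\le i\le n$, $(X^i\cap X^i_R)\not\subseteq Q_i^S$ or $X^i\cap X^i_R=\emptyset$, then $G_1\|\cdots\|G_n$ is infinite-step opaque.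
   Context: An automaton is $G=\langle\Sigma_\tau,Q,\to,Q^\circ\rangle$ with finite set $\Sigma$ of observable events, a special unobservable event $\tau\notin\Sigma$, $\Sigma_\tau=\Sigma\cup\{\tau\}$, finite states $Q$, transitions $\to\subseteq Q\times\Sigma_\tau\times Q$, initial states $Q^\circ$, and secret states $Q^S\subseteq Q$, $Q^{NS}=Q\setminus Q^S$. For $s\in\Sigma^*$, $p\stackrel{s}{\Rightarrow}q$ means there is $t\in\Sigma_\tau^*$ which becomes $s$ after deleting all $\tau$'s and $p\stackrel{t}{\to}q$; $p\stackrel{s}{\Rightarrow}$ means this for some $q$; $L(G,q)=\{s:q\stackrel{s}{\Rightarrow}\}$. Synchronous composition: states are tuples, initial states products of initial states; a shared event (other than $\tau$, never shared) is executed jointly by all components having it in their alphabet; other events are executed by a single component while the others stay put. Infinite-step opacity: $G$ is infinite-step opaque w.r.t. $Q^S$ iff for every $q^\circ\in Q^\circ$ and all $s,t\in\Sigma^*$ with $st\in L(G,q^\circ)$ and $q^\circ\stackrel{s}{\Rightarrow}Q^S$, there exist $q'^\circ\in Q^\circ$ and $y\in Q^{NS}$ with $q'^\circ\stackrel{s}{\Rightarrow}y$ and $y\stackrel{t}{\Rightarrow}$. Reversed automaton: $G_R=\langle\Sigma_\tau,Q,\to_R,Q\rangle$ with $(x,\sigma,y)\in\to_R$ iff $y\stackrel{\sigma}{\to}x$, all states initial. Current-state estimator: $UR(B)$ is the set of states reachable from $B$ by strings in $\{\tau\}^*$; $det(G)$ is the deterministic automaton over $\Sigma$ with initial state $UR(Q^\circ)$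 and transitions $X\stackrel{\sigma}{\to}Y$ where $Y=\bigcup\{UR(\{y\}): x\stackrel{\sigma}{\to}y, x\in X\}$ is nonempty; only reachable states are kept. Renamings $\Delta(\sigma)=(\sigma,\epsilon)$, $\Delta_R(\sigma)=(\epsilon,\sigma)$ relabel transitions; the two-way observer $H_i=\Delta(det(G_i))\|\Delta_R(det(G_{i,R}))$ has event set $\Delta(\Sigma_i)\cup\Delta_R(\Sigma_i)$ and states $(X^i,X^i_R)$ with $X^i,X^i_R\subseteq Q_i$; $H_1\|\cdots\|H_n$ synchronizes on common renamed events. -}

module Defs where

open import Level using (Level; 0ℓ; Lift) renaming (suc to lsuc)
open import Data.Nat using (ℕ)
open import Data.Fin using (Fin)
open import Data.Maybe using (Maybe; just; nothing)
open import Data.Sum using (_⊎_; inj₁; inj₂)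
open import Data.Product using (Σ; ∃; ∃-syntax; _×_; _,_; proj₁; proj₂)
open import Data.List using (List; []; _∷_; _++_; map; catMaybes; replicate)
open import Data.Empty using (⊥)
open import Data.Unit using (⊤)
open import Relation.Nullary using (¬_)
open import Relation.Unary using (Pred; Satisfiable; _∩_; ∁; Empty; ｛_｝)
open import Relation.Binary.PropositionalEquality using (_≡_; _≢_)

-- Automata  G = ⟨Σ_τ, Q, →, Q°⟩  over observable events A.
-- The unobservable event τ is represented by  nothing : Maybe A,
-- an observable event σ by  just σ.  Alph is the (observable) alphabet.

record Automaton (ℓ : Level) (A : Set) : Set (lsuc ℓ) where
  field
    State : Set ℓ
    Alph  : Pred A 0ℓ
    Trans : State → Maybe A → State → Set ℓ
    Init  : Pred State ℓ
open Automaton public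

WellFormed : ∀ {ℓ A} → Automaton ℓ A → Set ℓ
WellFormed G = ∀ {p e q} → Trans G p (just e) q → Alph G e

module _ {ℓ : Level} {A : Set} (G : Automaton ℓ A) where

  data Run : State G → List (Maybe A) → State G → Set ℓ where
    []  : ∀ {p} → Run p [] p
    _∷_ : ∀ {p a q as r} → Trans G p a q → Run q as r → Run p (a ∷ as) r

  _⇒[_]_ : State G → List A → State G → Set ℓ
  p ⇒[ s ] q = ∃[ t ] (catMaybes t ≡ s × Run p t q)

  Reachable : Pred (State G) ℓ
  Reachable x = ∃[ x₀ ] ∃[ s ] (Init G x₀ × Run x₀ (map just s) x)

  InfiniteStepOpaque : Pred (State G) ℓ → Set ℓ
  InfiniteStepOpaque S =
    ∀ q₀ → Init G q₀ → ∀ (s t : List A) →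
    (∃[ q ] (q₀ ⇒[ s ] q × q ∈' S)) →
    (∃[ q ] (q₀ ⇒[ s ++ t ] q)) →
    ∃[ q₀' ] ∃[ y ] (Init G q₀' × y ∈' ∁ S × q₀' ⇒[ s ] y × ∃[ z ] (y ⇒[ t ] z))
    where
      _∈'_ : State G → Pred (State G) ℓ → Set ℓ
      x ∈' P = P x

  τ* : State G → State G → Set ℓ
  τ* p q = ∃[ k ] Run p (replicate k nothing) q

module _ {A : Set} (G : Automaton 0ℓ A) where

  UR : Pred (State G) 0ℓ → Pred (State G) 0ℓ
  UR B z = ∃[ x ] (B x × τ* G x z)

  post : Pred (State G) 0ℓ → A → Pred (State G) 0ℓ
  post X σ z = ∃[ x ] ∃[ y ] (X x × Trans G x (just σ) y × UR ｛ y ｝ z)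

  private
    detTrans : Pred (State G) 0ℓ → Maybe A → Pred (State G) 0ℓ → Set₁
    detTrans X nothing  Y = Lift (lsuc 0ℓ) ⊥
    detTrans X (just σ) Y = (Y ≡ post X σ) × Satisfiable Y

  det : Automaton (lsuc 0ℓ) A
  det = record
    { State = Pred (State G) 0ℓ
    ; Alph  = Alph G
    ; Trans = detTrans
    ; Init  = λ X → X ≡ UR (Init G)
    }

rev : ∀ {ℓ A} → Automaton ℓ A → Automaton ℓ A
rev {ℓ} G = record
  { State = State G
  ; Alph  = Alph G
  ; Trans = λ x a y → Trans G y a x
  ; Init  = λ _ → Lift ℓ ⊤
  }

relabel : ∀ {ℓ A B} → (A → B) → Automaton ℓ A → Automaton ℓ B
relabel {ℓ} {A} {B} f G = record
  { State = State G
  ; Alph  = λ b → ∃[ a ] (Alph G a × f a ≡ b)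
  ; Trans = tr
  ; Init  = Init G
  }
  where
    tr : State G → Maybe B → State G → Set ℓ
    tr p nothing  q = Trans G p nothing q
    tr p (just b) q = ∃[ a ] (f a ≡ b × Trans G p (just a) q)

-- Δ(σ) = (σ, ε)  and  Δ_R(σ) = (ε, σ)
Δ : ∀ {ℓ A} → Automaton ℓ A → Automaton ℓ (A ⊎ A)
Δ = relabel inj₁

Δᴿ : ∀ {ℓ A} → Automaton ℓ A → Automaton ℓ (A ⊎ A)
Δᴿ = relabel inj₂

module _ {ℓ : Level} {A : Set} where

  _∥_ : Automaton ℓ A → Automaton ℓ A → Automaton ℓ A
  G₁ ∥ G₂ = record
    { State = State G₁ × State G₂
    ; Alph  = λ e → Alph G₁ e ⊎ Alph G₂ e
    ; Trans = tr
    ; Init  = λ p → Init G₁ (proj₁ p) × Init G₂ (proj₂ p)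
    }
    where
      tr : State G₁ × State G₂ → Maybe A → State G₁ × State G₂ → Set ℓ
      tr (p₁ , p₂) nothing (q₁ , q₂) =
        (Trans G₁ p₁ nothing q₁ × q₂ ≡ p₂) ⊎ (q₁ ≡ p₁ × Trans G₂ p₂ nothing q₂)
      tr (p₁ , p₂) (just e) (q₁ , q₂) =
        (Alph G₁ e ⊎ Alph G₂ e)
        × ((Alph G₁ e → Trans G₁ p₁ (just e) q₁) × (¬ Alph G₁ e → q₁ ≡ p₁))
        × ((Alph G₂ e → Trans G₂ p₂ (just e) q₂) × (¬ Alph G₂ e → q₂ ≡ p₂))

  ∥[_] : (n : ℕ) → (Fin n → Automaton ℓ A) → Automaton ℓ A
  ∥[ n ] F = record
    { State = (i : Fin n) → State (F i)
    ; Alph  = λ e → ∃[ i ] Alph (F i) e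
    ; Trans = tr
    ; Init  = λ p → ∀ i → Init (F i) (p i)
    }
    where
      tr : ((i : Fin n) → State (F i)) → Maybe A → ((i : Fin n) → State (F i)) → Set ℓ
      tr p nothing q =
        ∃[ i ] (Trans (F i) (p i) nothing (q i) × (∀ j → j ≢ i → q j ≡ p j))
      tr p (just e) q =
        (∃[ i ] Alph (F i) e)
        × (∀ i → (Alph (F i) e → Trans (F i) (p i) (just e) (q i))
                 × (¬ Alph (F i) e → q i ≡ p i))

TwoWayObserver : ∀ {A} → Automaton 0ℓ A → Automaton (lsuc 0ℓ) (A ⊎ A)
TwoWayObserver G = Δ (det G) ∥ Δᴿ (det (rev G))

SecretOr : ∀ {A n} (G : Fin n → Automaton 0ℓ A)
         → ((i : Fin n) → Pred (State (G i)) 0ℓ) → Pred (State (∥[ n ] G)) 0ℓ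
SecretOr G S = ∁ (λ q → ∀ i → ∁ (S i) (q i))

ObserverCondition : ∀ {Q : Set} → Pred Q 0ℓ → Pred Q 0ℓ × Pred Q 0ℓ → Set
ObserverCondition S (X , XR) = Satisfiable ((X ∩ XR) ∩ ∁ S) ⊎ Empty (X ∩ XR)

-- Let q₀ =s=> r =t=> q be a run of G₁ ∥ ⋯ ∥ Gₙ from an initial state with r
-- secret.  Projecting the run onto the components, every rᵢ lies both in the
-- forward estimate Xᵢ of Gᵢ after s (the state of det(Gᵢ) after the events of s
-- in Gᵢ's alphabet) and in the backward estimate Xᵢᴿ of the reversed automaton
-- after reverse t.  Since each intersection is nonempty, the tuple of pairs
-- (Xᵢ , Xᵢᴿ) is reachable in H₁ ∥ ⋯ ∥ Hₙ, by the word that first feeds s to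
-- the forward observers and then reverse t to the backward ones.  The
-- hypothesis then gives a non-secret yᵢ ∈ Xᵢ ∩ Xᵢᴿ for every i; unfolding
-- the estimates, yᵢ is reached from an initial state by the projection of s
-- and can continue with the projection of t.  Gluing these component runs
-- back together gives a non-secret state y of the composition with
-- q₀' =s=> y =t=> z, as infinite-step opacity demands.

module Submission where

open import Defs
open import Level using (0ℓ; lift) renaming (suc to lsuc)
open import Data.Nat using (ℕ; zero; suc)
open import Data.Fin using (Fin; _≟_)
open import Data.Maybe using (Maybe; just; nothing)
open import Data.Sum using (_⊎_; inj₁; inj₂)
open import Data.Product using (Σ; ∃-syntax; _×_; _,_; proj₁; proj₂)
open import Data.List using (List; []; _∷_; _++_; [_]; map; catMaybes; replicate; reverse; filter; allFin)
open import Data.List.Properties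
  using (map-++; unfold-reverse; filter-++; ++-identityʳ; reverse-involutive)
open import Data.List.Relation.Unary.All using (All; []; _∷_; tabulate; lookup)
open import Data.List.Relation.Unary.Any using (here; there)
open import Data.List.Relation.Unary.Any.Properties using (reverse⁻)
open import Data.List.Membership.Propositional using (_∈_)
open import Data.List.Membership.Propositional.Properties using (∈-allFin)
open import Data.Empty using (⊥-elim)
open import Data.Unit using (tt)
open import Function.Bundles using (_↔_)
open import Relation.Nullary using (¬_; Dec; yes; no)
open import Relation.Unary using (Pred; Decidable; Satisfiable; ∁)
open import Relation.Binary.PropositionalEquality
  using (_≡_; _≢_; refl; sym; trans; cong; subst; module ≡-Reasoning)

data WeakRun {ℓ} {S : Set ℓ} {A : Set} (T : S → Maybe A → S → Set ℓ)
     : S → List A → S → Set ℓ where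
  done   : ∀ {p} → WeakRun T p [] p
  τ-step : ∀ {p q s r} → T p nothing q → WeakRun T q s r → WeakRun T p s r
  σ-step : ∀ {p e q s r} → T p (just e) q → WeakRun T q s r → WeakRun T p (e ∷ s) r

module _ {ℓ} {S : Set ℓ} {A : Set} {T : S → Maybe A → S → Set ℓ} where

  _++ʷ_ : ∀ {a u b v c} → WeakRun T a u b → WeakRun T b v c → WeakRun T a (u ++ v) c
  done       ++ʷ w′ = w′
  τ-step t w ++ʷ w′ = τ-step t (w ++ʷ w′)
  σ-step t w ++ʷ w′ = σ-step t (w ++ʷ w′)

  splitʷ : ∀ {a} u {v c} → WeakRun T a (u ++ v) c → ∃[ b ] (WeakRun T a u b × WeakRun T b v c)
  splitʷ []      w            = _ , done , w
  splitʷ (e ∷ u) (τ-step t w) with b , w₁ , w₂ ← splitʷ (e ∷ u) w = b , τ-step t w₁ , w₂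
  splitʷ (e ∷ u) (σ-step t w) with b , w₁ , w₂ ← splitʷ u w       = b , σ-step t w₁ , w₂

  firstStep : ∀ {a e s c} → WeakRun T a (e ∷ s) c →
    ∃[ a′ ] ∃[ b ] (WeakRun T a [] a′ × T a′ (just e) b × WeakRun T b s c)
  firstStep (τ-step t w) with a′ , b , w₁ , t′ , w₂ ← firstStep w = a′ , b , τ-step t w₁ , t′ , w₂
  firstStep (σ-step t w) = _ , _ , done , t , w

  snocτ : ∀ {a u b c} → WeakRun T a u b → T b nothing c → WeakRun T a u c
  snocτ done         t = τ-step t done
  snocτ (τ-step x w) t = τ-step x (snocτ w t)
  snocτ (σ-step x w) t = σ-step x (snocτ w t)

reverseʷ : ∀ {ℓ} {S : Set ℓ} {A : Set} {T : S → Maybe A → S → Set ℓ} {x v z} →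
  WeakRun (λ a m b → T b m a) x v z → WeakRun T z (reverse v) x
reverseʷ done         = done
reverseʷ (τ-step t w) = snocτ (reverseʷ w) t
reverseʷ {T = T} (σ-step {e = e} {s = s} t w) =
  subst (λ u → WeakRun T _ u _) (sym (unfold-reverse e s)) (reverseʷ w ++ʷ σ-step t done)

module _ {ℓ} {A : Set} (G : Automaton ℓ A) where

  weaken : ∀ {p w q} → Run G p w q → WeakRun (Trans G) p (catMaybes w) q
  weaken []                      = done
  weaken (_∷_ {a = nothing} t r) = τ-step t (weaken r)
  weaken (_∷_ {a = just e}  t r) = σ-step t (weaken r)

  toArrow : ∀ {p s q} → WeakRun (Trans G) p s q → _⇒[_]_ G p s q
  toArrow done = [] , refl , []
  toArrow (τ-step t w) with ts , eq , r ← toArrow w = nothing ∷ ts , eq , t ∷ r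
  toArrow (σ-step {e = e} t w) with ts , eq , r ← toArrow w = just e ∷ ts , cong (e ∷_) eq , t ∷ r

  fromArrow : ∀ {p s q} → _⇒[_]_ G p s q → WeakRun (Trans G) p s q
  fromArrow (ts , eq , r) = subst (λ s → WeakRun (Trans G) _ s _) eq (weaken r)

  catMaybes-τs : ∀ k → catMaybes (replicate {A = Maybe A} k nothing) ≡ []
  catMaybes-τs zero    = refl
  catMaybes-τs (suc k) = catMaybes-τs k

  fromτ* : ∀ {p q} → τ* G p q → WeakRun (Trans G) p [] q
  fromτ* (k , r) = subst (λ s → WeakRun (Trans G) _ s _) (catMaybes-τs k) (weaken r)

  τ*-snoc : ∀ {a b c} k → Run G a (replicate k nothing) b → Trans G b nothing c →
    Run G a (replicate (suc k) nothing) c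
  τ*-snoc zero    []      t = t ∷ []
  τ*-snoc (suc k) (x ∷ r) t = x ∷ τ*-snoc k r t

filter-reverse : ∀ {A : Set} {P : Pred A 0ℓ} (P? : Decidable P) xs →
  filter P? (reverse xs) ≡ reverse (filter P? xs)
filter-reverse P? []       = refl
filter-reverse P? (x ∷ xs) = begin
  filter P? (reverse (x ∷ xs))              ≡⟨ cong (filter P?) (unfold-reverse x xs) ⟩
  filter P? (reverse xs ++ [ x ])           ≡⟨ filter-++ P? (reverse xs) [ x ] ⟩
  filter P? (reverse xs) ++ filter P? [ x ] ≡⟨ cong (_++ filter P? [ x ]) (filter-reverse P? xs) ⟩
  reverse (filter P? xs) ++ filter P? [ x ] ≡⟨ snoc-filter ⟩
  reverse (filter P? (x ∷ xs))              ∎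
  where
  open ≡-Reasoning
  snoc-filter : reverse (filter P? xs) ++ filter P? [ x ] ≡ reverse (filter P? (x ∷ xs))
  snoc-filter with P? x
  ... | yes _ = sym (unfold-reverse x (filter P? xs))
  ... | no  _ = ++-identityʳ (reverse (filter P? xs))

All-reverse : ∀ {A : Set} {P : Pred A 0ℓ} {xs : List A} → All P xs → All P (reverse xs)
All-reverse pxs = tabulate (λ x∈ → lookup pxs (reverse⁻ x∈))

-- Current-state estimates.  estimate X s is the state that det(G) reaches
-- from X on s when events outside G's alphabet leave it unchanged, as they
-- do inside a synchronous composition.
module Estimate {A : Set} (G : Automaton 0ℓ A) (Alph? : Decidable (Alph G)) where

  advance : Pred (State G) 0ℓ → (e : A) → Dec (Alph G e) → Pred (State G) 0ℓ
  advance X e (yes _) = post G X e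
  advance X e (no _)  = X

  estimate : Pred (State G) 0ℓ → List A → Pred (State G) 0ℓ
  estimate X []      = X
  estimate X (e ∷ s) = estimate (advance X e (Alph? e)) s

  TauClosed : Pred (State G) 0ℓ → Set
  TauClosed X = ∀ {a b} → X a → Trans G a nothing b → X b

  post-closed : ∀ X e → TauClosed (post G X e)
  post-closed X e (x , y , x∈X , t , y′ , refl , k , r) t′ =
    x , y , x∈X , t , y′ , refl , suc k , τ*-snoc G k r t′

  UR-closed : ∀ B → TauClosed (UR G B)
  UR-closed B (x , x∈B , k , r) t′ = x , x∈B , suc k , τ*-snoc G k r t′

  closed-silent : ∀ {X a b} → TauClosed X → X a → WeakRun (Trans G) a [] b → X b
  closed-silent closed a∈X done         = a∈X
  closed-silent closed a∈X (τ-step t w) = closed-silent closed (closed a∈X t) w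

  estimate-sound : ∀ {X x} s {z} → TauClosed X → X x →
    WeakRun (Trans G) x (filter Alph? s) z → estimate X s z
  estimate-sound []          closed x∈X w = closed-silent closed x∈X w
  estimate-sound {X} (e ∷ s) closed x∈X w with Alph? e
  ... | no  _ = estimate-sound s closed x∈X w
  ... | yes _ with a , b , w₁ , t , w₂ ← firstStep w =
    estimate-sound s (post-closed X e) (a , b , closed-silent closed x∈X w₁ , t , b , refl , zero , []) w₂

  estimate-complete : ∀ {X} s {z} → estimate X s z →
    ∃[ x ] (X x × WeakRun (Trans G) x (filter Alph? s) z)
  estimate-complete []      z∈ = _ , z∈ , done
  estimate-complete (e ∷ s) z∈ with Alph? e
  ... | no  _ = estimate-complete s z∈
  ... | yes _ with y , (x , _ , x∈X , t , _ , refl , τs) , w ← estimate-complete s z∈ =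
    x , x∈X , σ-step t (fromτ* G τs ++ʷ w)

  estimate-nonempty : ∀ {X} s → Satisfiable (estimate X s) → Satisfiable X
  estimate-nonempty s (z , z∈) with x , x∈X , _ ← estimate-complete s z∈ = x , x∈X

MovesOrStays : ∀ {ℓ A} (F : Automaton ℓ A) → State F → A → State F → Set ℓ
MovesOrStays F p e q = (Alph F e → Trans F p (just e) q) × (¬ Alph F e → q ≡ p)

module Composition {A : Set} {n : ℕ} (F : Fin n → Automaton 0ℓ A)
                   (Alph? : ∀ i → Decidable (Alph (F i))) where

  St : Set
  St = (i : Fin n) → State (F i)

  Step : St → Maybe A → St → Set
  Step = Trans (∥[ n ] F)

  _≋_ : St → St → Set
  p ≋ q = ∀ i → p i ≡ q i

  InAlph : Pred A 0ℓ
  InAlph e = ∃[ i ] Alph (F i) e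

  ComponentRuns : St → List A → St → Set
  ComponentRuns p s q = ∀ i → WeakRun (Trans (F i)) (p i) (filter (Alph? i) s) (q i)

  project : ∀ {p s q} → WeakRun Step p s q → ComponentRuns p s q
  project done i = done
  project (τ-step (j , t , others) w) i with i ≟ j
  ... | yes refl = τ-step t (project w i)
  ... | no  i≢j  = subst (λ a → WeakRun _ a _ _) (others i i≢j) (project w i)
  project (σ-step {e = e} (_ , clauses) w) i with Alph? i e
  ... | yes e∈ = σ-step (proj₁ (clauses i) e∈) (project w i)
  ... | no  e∉ = subst (λ a → WeakRun _ a _ _) (proj₂ (clauses i) e∉) (project w i)

  events-in-alphabet : ∀ {p s q} → WeakRun Step p s q → All InAlph s
  events-in-alphabet done                = []
  events-in-alphabet (τ-step _ w)        = events-in-alphabet w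
  events-in-alphabet (σ-step (e∈ , _) w) = e∈ ∷ events-in-alphabet w

  update : St → (j : Fin n) → State (F j) → St
  update p j v i with j ≟ i
  ... | yes refl = v
  ... | no  _    = p i

  update-same : ∀ p j v → update p j v j ≡ v
  update-same p j v with j ≟ j
  ... | yes refl = refl
  ... | no  j≢j  = ⊥-elim (j≢j refl)

  update-other : ∀ p j v i → i ≢ j → update p j v i ≡ p i
  update-other p j v i i≢j with j ≟ i
  ... | yes refl = ⊥-elim (i≢j refl)
  ... | no  _    = refl

  liftSilent : ∀ p j {u v} → u ≡ p j → WeakRun (Trans (F j)) u [] v →
    ∃[ e ] (WeakRun Step p [] e × e j ≡ v × (∀ i → i ≢ j → e i ≡ p i))
  liftSilent p j refl done = p , done , refl , λ _ _ → refl
  liftSilent p j refl (τ-step {q = q₁} t w)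
    with e , w′ , ej≡v , rest ← liftSilent (update p j q₁) j (sym (update-same p j q₁)) w =
    e , τ-step step w′ , ej≡v , λ i i≢j → trans (rest i i≢j) (update-other p j q₁ i i≢j)
    where
    step : Step p nothing (update p j q₁)
    step = j , subst (Trans (F j) (p j) nothing) (sym (update-same p j q₁)) t ,
           update-other p j q₁

  -- silent runs of all components interleave into one silent composite run;
  -- the components still to be moved are those listed in L
  interleaveSilent : ∀ (L : List (Fin n)) (p q : St) → (∀ i → (i ∈ L) ⊎ (p i ≡ q i)) →
    ComponentRuns p [] q → ∃[ e ] (WeakRun Step p [] e × e ≋ q)
  interleaveSilent [] p q pending W = p , done , λ i → settled (pending i)
    where
    settled : ∀ {i} → (i ∈ []) ⊎ (p i ≡ q i) → p i ≡ q i
    settled (inj₁ ())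
    settled (inj₂ eq) = eq
  interleaveSilent (j ∷ L) p q pending W
    with e₁ , w₁ , e₁j≡qj , rest ← liftSilent p j refl (W j) =
    let (e₂ , w₂ , e₂≋q) = interleaveSilent L e₁ q pending′ W′ in e₂ , w₁ ++ʷ w₂ , e₂≋q
    where
    pending′ : ∀ i → (i ∈ L) ⊎ (e₁ i ≡ q i)
    pending′ i with i ≟ j | pending i
    ... | yes refl | _               = inj₂ e₁j≡qj
    ... | no  i≢j  | inj₁ (here i≡j) = ⊥-elim (i≢j i≡j)
    ... | no  i≢j  | inj₁ (there i∈) = inj₁ i∈
    ... | no  i≢j  | inj₂ pi≡qi      = inj₂ (trans (rest i i≢j) pi≡qi)
    W′ : ComponentRuns e₁ [] q
    W′ i with i ≟ j
    ... | yes refl = subst (λ a → WeakRun _ a [] (q j)) (sym e₁j≡qj) done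
    ... | no  i≢j  = subst (λ a → WeakRun _ a [] (q i)) (sym (rest i i≢j)) (W i)

  record CutAt (i : Fin n) (e : A) (s : List A) (p q : State (F i)) : Set where
    field
      before after : State (F i)
      silent       : WeakRun (Trans (F i)) p [] before
      moveOrStay   : MovesOrStays (F i) before e after
      rest         : WeakRun (Trans (F i)) after (filter (Alph? i) s) q

  cutAt : ∀ i e s {p q} → WeakRun (Trans (F i)) p (filter (Alph? i) (e ∷ s)) q → CutAt i e s p q
  cutAt i e s w with Alph? i e
  ... | yes e∈ with a , b , w₁ , t , w₂ ← firstStep w =
    record { silent = w₁ ; moveOrStay = (λ _ → t) , (λ e∉ → ⊥-elim (e∉ e∈)) ; rest = w₂ }
  ... | no  e∉ =
    record { silent = done ; moveOrStay = (λ e∈ → ⊥-elim (e∉ e∈)) , (λ _ → refl) ; rest = w }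

  interleave : ∀ s (p q : St) → All InAlph s → ComponentRuns p s q →
    ∃[ e ] (WeakRun Step p s e × e ≋ q)
  interleave []      p q _ W = interleaveSilent (allFin n) p q (λ i → inj₁ (∈-allFin i)) W
  interleave (e ∷ s) p q (e∈ ∷ s∈) W = viaCuts (λ i → cutAt i e s (W i))
    where
    viaCuts : (∀ i → CutAt i e s (p i) (q i)) → ∃[ r ] (WeakRun Step p (e ∷ s) r × r ≋ q)
    viaCuts cut
      with e₁ , w₁ , e₁≋before ← interleaveSilent (allFin n) p (λ i → CutAt.before (cut i))
                                   (λ i → inj₁ (∈-allFin i)) (λ i → CutAt.silent (cut i))
         | e₂ , w₂ , e₂≋q ← interleave s (λ i → CutAt.after (cut i)) q s∈ (λ i → CutAt.rest (cut i)) =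
      e₂ , w₁ ++ʷ σ-step (e∈ , clause) w₂ , e₂≋q
      where
      clause : ∀ i → MovesOrStays (F i) (e₁ i) e (CutAt.after (cut i))
      clause i = subst (λ a → MovesOrStays (F i) a e (CutAt.after (cut i)))
                       (sym (e₁≋before i)) (CutAt.moveOrStay (cut i))

module TwoWayStep {A : Set} (G : Automaton 0ℓ A) (Alph? : Decidable (Alph G)) where
  open Estimate G Alph? using (advance)
  private module Back = Estimate (rev G) Alph?

  H : Automaton (lsuc 0ℓ) (A ⊎ A)
  H = TwoWayObserver G

  forward : ∀ X Xᴿ e (d : Dec (Alph G e)) → Satisfiable (advance X e d) →
    MovesOrStays H (X , Xᴿ) (inj₁ e) (advance X e d , Xᴿ)
  forward X Xᴿ e (yes e∈) nonempty =
    (λ e∈H → e∈H , ((λ _ → e , refl , refl , nonempty) , (λ e∉ → ⊥-elim (e∉ (e , e∈ , refl))))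
                 , ((λ { (_ , _ , ()) }) , (λ _ → refl)))
    , (λ e∉H → ⊥-elim (e∉H (inj₁ (e , e∈ , refl))))
  forward X Xᴿ e (no e∉) _ =
    (λ { (inj₁ (_ , e∈ , refl)) → ⊥-elim (e∉ e∈) ; (inj₂ (_ , _ , ())) }) , (λ _ → refl)

  backward : ∀ X Xᴿ e (d : Dec (Alph G e)) → Satisfiable (Back.advance Xᴿ e d) →
    MovesOrStays H (X , Xᴿ) (inj₂ e) (X , Back.advance Xᴿ e d)
  backward X Xᴿ e (yes e∈) nonempty =
    (λ e∈H → e∈H , ((λ { (_ , _ , ()) }) , (λ _ → refl))
                 , ((λ _ → e , refl , refl , nonempty) , (λ e∉ → ⊥-elim (e∉ (e , e∈ , refl)))))
    , (λ e∉H → ⊥-elim (e∉H (inj₂ (e , e∈ , refl))))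
  backward X Xᴿ e (no e∉) _ =
    (λ { (inj₂ (_ , e∈ , refl)) → ⊥-elim (e∉ e∈) ; (inj₁ (_ , _ , ())) }) , (λ _ → refl)

Run-++ : ∀ {ℓ A} {G : Automaton ℓ A} {a u b v c} → Run G a u b → Run G b v c → Run G a (u ++ v) c
Run-++ []      r′ = r′
Run-++ (t ∷ r) r′ = t ∷ Run-++ r r′

module TwoWayObservers {A : Set} {n : ℕ} (G : Fin n → Automaton 0ℓ A)
                       (Alph? : ∀ i → Decidable (Alph (G i))) where
  open Composition G Alph? using (St; InAlph; ComponentRuns; _≋_; interleave)
  module Fwd i = Estimate (G i) (Alph? i)
  module Bwd i = Estimate (rev (G i)) (Alph? i)

  ℍ : Automaton (lsuc 0ℓ) (A ⊎ A)
  ℍ = ∥[ n ] (λ i → TwoWayObserver (G i))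

  runForward : ∀ (x : State ℍ) s → All InAlph s →
    (∀ i → Satisfiable (Fwd.estimate i (proj₁ (x i)) s)) →
    Run ℍ x (map just (map inj₁ s)) (λ i → Fwd.estimate i (proj₁ (x i)) s , proj₂ (x i))
  runForward x []      _                _        = []
  runForward x (e ∷ s) ((j , e∈) ∷ s∈) nonempty =
    ((j , inj₁ (e , e∈ , refl)) ,
     λ i → TwoWayStep.forward (G i) (Alph? i) (proj₁ (x i)) (proj₂ (x i)) e (Alph? i e)
             (Fwd.estimate-nonempty i s (nonempty i)))
    ∷ runForward _ s s∈ nonempty

  runBackward : ∀ (x : State ℍ) u → All InAlph u →
    (∀ i → Satisfiable (Bwd.estimate i (proj₂ (x i)) u)) →
    Run ℍ x (map just (map inj₂ u)) (λ i → proj₁ (x i) , Bwd.estimate i (proj₂ (x i)) u)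
  runBackward x []      _                _        = []
  runBackward x (e ∷ u) ((j , e∈) ∷ u∈) nonempty =
    ((j , inj₂ (e , e∈ , refl)) ,
     λ i → TwoWayStep.backward (G i) (Alph? i) (proj₁ (x i)) (proj₂ (x i)) e (Alph? i e)
             (Bwd.estimate-nonempty i u (nonempty i)))
    ∷ runBackward _ u u∈ nonempty

  -- the pair of estimates after s forwards and u backwards, from the initial
  -- observer state (UR(Q°ᵢ) , Qᵢ) of every component
  X₀ X₀ᴿ : ∀ i → Pred (State (G i)) 0ℓ
  X₀  i = UR (G i) (Init (G i))
  X₀ᴿ i = UR (rev (G i)) (Init (rev (G i)))

  twoWayEstimate : List A → List A → State ℍ
  twoWayEstimate s u i = Fwd.estimate i (X₀ i) s , Bwd.estimate i (X₀ᴿ i) u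

  InBothAt : List A → List A → ∀ i → Pred (State (G i)) 0ℓ
  InBothAt s u i y = Fwd.estimate i (X₀ i) s y × Bwd.estimate i (X₀ᴿ i) u y

  InBoth : List A → List A → St → Set
  InBoth s u r = ∀ i → InBothAt s u i (r i)

  twoWayEstimate-reachable : ∀ {s u r} → All InAlph s → All InAlph u → InBoth s u r →
    Reachable ℍ (twoWayEstimate s u)
  twoWayEstimate-reachable {s} {u} {r} s∈ u∈ r∈ =
    x₀ , map inj₁ s ++ map inj₂ u , (λ i → refl , refl) ,
    subst (λ w → Run ℍ x₀ w (twoWayEstimate s u)) (sym (map-++ just (map inj₁ s) (map inj₂ u)))
      (Run-++ (runForward x₀ s s∈ (λ i → r i , proj₁ (r∈ i)))
              (runBackward _ u u∈ (λ i → r i , proj₂ (r∈ i))))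
    where
    x₀ : State ℍ
    x₀ i = X₀ i , X₀ᴿ i

  midpoint-inBoth : ∀ {q₀ s r t q} → (∀ i → Init (G i) (q₀ i)) →
    ComponentRuns q₀ s r → ComponentRuns r t q → InBoth s (reverse t) r
  midpoint-inBoth {s = s} {r} {t} {q} init W₁ W₂ i =
    Fwd.estimate-sound i s (Fwd.UR-closed i (Init (G i))) (_ , init i , zero , []) (W₁ i) ,
    Bwd.estimate-sound i (reverse t) (Bwd.UR-closed i _) (q i , lift tt , zero , [])
      (subst (λ w → WeakRun _ (q i) w (r i)) (sym (filter-reverse (Alph? i) t))
        (reverseʷ {T = Trans (rev (G i))} (W₂ i)))

  forward-origin : ∀ i s {y} → Fwd.estimate i (X₀ i) s y →
    ∃[ q ] (Init (G i) q × WeakRun (Trans (G i)) q (filter (Alph? i) s) y)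
  forward-origin i s y∈ with _ , (q , q-init , τs) , w ← Fwd.estimate-complete i s y∈ =
    q , q-init , fromτ* (G i) τs ++ʷ w

  backward-future : ∀ i t {y} → Bwd.estimate i (X₀ᴿ i) (reverse t) y →
    ∃[ z ] WeakRun (Trans (G i)) y (filter (Alph? i) t) z
  backward-future i t {y} y∈ with z , _ , w ← Bwd.estimate-complete i (reverse t) y∈ =
    z , subst (λ v → WeakRun _ y v z) reverse-filter-reverse (reverseʷ {T = Trans (G i)} w)
    where
    reverse-filter-reverse : reverse (filter (Alph? i) (reverse t)) ≡ filter (Alph? i) t
    reverse-filter-reverse =
      trans (cong reverse (filter-reverse (Alph? i) t)) (reverse-involutive (filter (Alph? i) t))

  inBoth-realised : ∀ {s t y} → All InAlph s → All InAlph t → InBoth s (reverse t) y →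
    ∃[ q₀ ] ∃[ y′ ] ((∀ i → Init (G i) (q₀ i)) × y′ ≋ y ×
      WeakRun (Trans (∥[ n ] G)) q₀ s y′ × ∃[ z ] WeakRun (Trans (∥[ n ] G)) y′ t z)
  inBoth-realised {s} {t} {y} s∈ t∈ y∈ =
    let (y′ , run-s , y′≋y) = interleave s q₀ y s∈ (λ i → proj₂ (proj₂ (origin i)))
        (z′ , run-t , _)    = interleave t y′ z t∈
                                (λ i → subst (λ a → WeakRun _ a _ _) (sym (y′≋y i)) (proj₂ (future i)))
    in q₀ , y′ , (λ i → proj₁ (proj₂ (origin i))) , y′≋y , run-s , z′ , run-t
    where
    origin : ∀ i → ∃[ q ] (Init (G i) q × WeakRun (Trans (G i)) q (filter (Alph? i) s) (y i))
    origin i = forward-origin i s (proj₁ (y∈ i))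
    future : ∀ i → ∃[ z ] WeakRun (Trans (G i)) (y i) (filter (Alph? i) t) z
    future i = backward-future i t (proj₂ (y∈ i))
    q₀ z : St
    q₀ i = proj₁ (origin i)
    z  i = proj₁ (future i)

theorem5 : ∀ {m n : ℕ}
    (G : Fin n → Automaton 0ℓ (Fin m))
    (S : (i : Fin n) → Pred (State (G i)) 0ℓ)
    → (∀ i → ∃[ k ] (State (G i) ↔ Fin k))
    → (∀ i → Decidable (Alph (G i)))
    → (∀ i → WellFormed (G i))
    → (∀ x → Reachable (∥[ n ] (λ i → TwoWayObserver (G i))) x
           → ∀ i → ObserverCondition (S i) (x i))
    → InfiniteStepOpaque (∥[ n ] G) (SecretOr G S)
theorem5 {n = n} G S _ Alph? _ condition q₀ init s t _ (q , q₀⇒st) =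
  let (q₀′ , y′ , init′ , y′≋y , run-s , z , run-t) = inBoth-realised s∈ t∈ y∈
  in q₀′ , y′ , init′ ,
     (λ secret → secret λ i → subst (∁ (S i)) (sym (y′≋y i)) (y-public i)) ,
     toArrow (∥[ n ] G) run-s , z , toArrow (∥[ n ] G) run-t
  where
  open Composition G Alph? using (St; Step; InAlph; project; events-in-alphabet)
  open TwoWayObservers G Alph?
  split : ∃[ r ] (WeakRun Step q₀ s r × WeakRun Step r t q)
  split = splitʷ s (fromArrow (∥[ n ] G) q₀⇒st)
  r : St
  r = proj₁ split
  s∈ : All InAlph s
  s∈ = events-in-alphabet (proj₁ (proj₂ split))
  t∈ : All InAlph t
  t∈ = events-in-alphabet (proj₂ (proj₂ split))
  r∈ : InBoth s (reverse t) r
  r∈ = midpoint-inBoth {s = s} {t = t} init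
         (project (proj₁ (proj₂ split))) (project (proj₂ (proj₂ split)))
  reach : Reachable ℍ (twoWayEstimate s (reverse t))
  reach = twoWayEstimate-reachable s∈ (All-reverse t∈) r∈
  -- the observer condition yields a non-secret state in both estimates;
  -- their intersection is not empty, as it contains the midpoint of the run
  choose : ∀ i → Σ (State (G i)) λ y → InBothAt s (reverse t) i y × ∁ (S i) y
  choose i with condition _ reach i
  ... | inj₁ (y , y∈ , y∉S) = y , y∈ , y∉S
  ... | inj₂ empty          = ⊥-elim (empty _ (r∈ i))
  y∈ : InBoth s (reverse t) (λ i → proj₁ (choose i))
  y∈ i = proj₁ (proj₂ (choose i))
  y-public : ∀ i → ∁ (S i) (proj₁ (choose i))
  y-public i = proj₂ (proj₂ (choose i))
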